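{- For each $k\geq 1$: if $k$ is odd, then $\Sigma^1_k\text{ - }\mathrm{KROM}^r\equiv\Sigma^1_{k+1}\text{ - }\mathrm{KROM}^r$; and if $k$ is even, then $\Pi^1_k\text{ - }\mathrm{KROM}^r\equiv\Pi^1_{k+1}\text{ - }\mathrm{KROM}^r$.
   Context: Vocabularies $\tau$ consist of constant and relation symbols and always contain equality; all structures are finite. $\mathrm{SO}\text{ - }\mathrm{KROM}^r(\tau)$ is the set of sentences $Q_1R_1\cdots Q_mR_m\forall\bar{x}(C_1\wedge\cdots\wedge C_n)$ with $Q_i\in\{\forall,\exists\}$, relation variables $R_i$, and each clause $C_j$ a disjunction $\beta_1\vee\cdots\vee\beta_q\vee H_1\vee H_2$ where each $\beta_s$ is $P\bar{y}$ or $\neg P\bar{y}$ with $P\in\tau$, and each $H_t$ is $R_i\bar{z}$, $\neg R_i\bar{z}$, $\exists z_1\cdots\exists z_r\,R_iz_1\cdots z_r$ ($r$ the arity of $R_i$), or $\bot$. $\Sigma^1_k\text{ - }\mathrm{KROM}^r$ (resp. $\Pi^1_k\text{ - }\mathrm{KROM}^r$) is the set of such sentences whose second-order prefix starts with an existential (resp. universal) quantifier and alternates $k-1$ times between blocks of existential and universal quantifiers. For logics $\mathcal{L}_1,\mathcal{L}_2$, $\mathcal{L}_1\equiv\mathcal{L}_2$ means every $\mathcal{L}_1$ formula is equivalent to an $\mathcal{L}_2$ formula and vice versa. -}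

module Defs where

open import Data.Nat using (ℕ; zero; suc; _≤_; _+_; _*_)
open import Data.Fin using (Fin)
open import Data.Vec using (Vec; map)
open import Data.List using (List; []; _∷_; length; lookup)
open import Data.List.Relation.Unary.All using (All)
open import Data.List.Relation.Unary.Any using (Any)
open import Data.Bool using (Bool; true)
open import Data.Product using (Σ; _×_; _,_; proj₁; proj₂)
open import Data.Sum using (_⊎_)
open import Data.Unit using (⊤; tt)
open import Data.Empty using (⊥)
open import Relation.Binary.PropositionalEquality using (_≡_)
open import Relation.Nullary using (¬_)
open import Function.Bundles using (_⇔_)

record Vocab : Set where
  field
    nConst : ℕ
    nRel   : ℕ
    arity  : Fin nRel → ℕ
open Vocab public

Rel : Set → ℕ → Set
Rel D r = Vec D r → Bool

record Structure (τ : Vocab) : Set where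
  field
    size   : ℕ
    const  : Fin (nConst τ) → Fin (suc size)
    rel    : (i : Fin (nRel τ)) → Rel (Fin (suc size)) (arity τ i)
open Structure public

Dom : ∀ {τ} → Structure τ → Set
Dom A = Fin (suc (size A))

data Quant : Set where
  ∀Q ∃Q : Quant

-- A second-order prefix Q₁R₁ ⋯ QₘRₘ: list of (quantifier, arity of Rᵢ).
Prefix : Set
Prefix = List (Quant × ℕ)

RVar : Prefix → Set
RVar p = Fin (length p)

rArity : (p : Prefix) → RVar p → ℕ
rArity p i = proj₂ (lookup p i)

data Term (τ : Vocab) (nv : ℕ) : Set where
  var   : Fin nv → Term τ nv
  con   : Fin (nConst τ) → Term τ nv

data Atom (τ : Vocab) (nv : ℕ) : Set where
  eqA  : Term τ nv → Term τ nv → Atom τ nv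
  relA : (P : Fin (nRel τ)) → Vec (Term τ nv) (arity τ P) → Atom τ nv

data Lit (τ : Vocab) (nv : ℕ) : Set where
  pos neg : Atom τ nv → Lit τ nv

data HLit (τ : Vocab) (nv : ℕ) (p : Prefix) : Set where
  posR  : (i : RVar p) → Vec (Term τ nv) (rArity p i) → HLit τ nv p
  negR  : (i : RVar p) → Vec (Term τ nv) (rArity p i) → HLit τ nv p
  exR   : (i : RVar p) → HLit τ nv p
  botH  : HLit τ nv p

record Clause (τ : Vocab) (nv : ℕ) (p : Prefix) : Set where
  constructor clause
  field
    betas : List (Lit τ nv)
    H₁    : HLit τ nv p
    H₂    : HLit τ nv p

-- Q₁R₁ ⋯ QₘRₘ ∀x̄ (C₁ ∧ ⋯ ∧ Cₙ)
record SOKrom (τ : Vocab) : Set where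
  constructor soKrom
  field
    prefix  : Prefix
    nv      : ℕ
    clauses : List (Clause τ nv prefix)
open SOKrom public

Env : Set → Prefix → Set
Env D []             = ⊤
Env D ((q , r) ∷ ps) = Rel D r × Env D ps

lookupEnv : ∀ {D} (p : Prefix) → Env D p → (i : RVar p) → Rel D (rArity p i)
lookupEnv ((q , r) ∷ ps) (R , e) Fin.zero    = R
lookupEnv ((q , r) ∷ ps) (R , e) (Fin.suc i) = lookupEnv ps e i

semPrefix : (D : Set) (p : Prefix) → (Env D p → Set) → Set
semPrefix D []               φ = φ tt
semPrefix D ((∀Q , r) ∷ ps) φ = (R : Rel D r) → semPrefix D ps (λ e → φ (R , e))
semPrefix D ((∃Q , r) ∷ ps) φ = Σ (Rel D r) (λ R → semPrefix D ps (λ e → φ (R , e)))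

module _ {τ : Vocab} (A : Structure τ) where

  evalTerm : ∀ {nv} → (Fin nv → Dom A) → Term τ nv → Dom A
  evalTerm s (var x) = s x
  evalTerm s (con c) = const A c

  evalTerms : ∀ {nv n} → (Fin nv → Dom A) → Vec (Term τ nv) n → Vec (Dom A) n
  evalTerms s ts = map (evalTerm s) ts

  satAtom : ∀ {nv} → (Fin nv → Dom A) → Atom τ nv → Set
  satAtom s (eqA t u)   = evalTerm s t ≡ evalTerm s u
  satAtom s (relA P ts) = rel A P (evalTerms s ts) ≡ true

  satLit : ∀ {nv} → (Fin nv → Dom A) → Lit τ nv → Set
  satLit s (pos a) = satAtom s a
  satLit s (neg a) = ¬ satAtom s a

  satH : ∀ {nv p} → Env (Dom A) p → (Fin nv → Dom A) → HLit τ nv p → Set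
  satH {p = p} e s (posR i ts) = lookupEnv p e i (evalTerms s ts) ≡ true
  satH {p = p} e s (negR i ts) = ¬ (lookupEnv p e i (evalTerms s ts) ≡ true)
  satH {p = p} e s (exR i)     = Σ (Vec (Dom A) (rArity p i)) (λ v → lookupEnv p e i v ≡ true)
  satH         e s botH        = ⊥

  satClause : ∀ {nv p} → Env (Dom A) p → (Fin nv → Dom A) → Clause τ nv p → Set
  satClause e s (clause βs h₁ h₂) = Any (satLit s) βs ⊎ satH e s h₁ ⊎ satH e s h₂

  _⊨_ : SOKrom τ → Set
  _⊨_ φ = semPrefix (Dom A) (prefix φ)
            (λ e → (s : Fin (nv φ) → Dom A) → All (satClause e s) (clauses φ))

blocksFrom : Quant → List (Quant × ℕ) → ℕ
blocksFrom q [] = 1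
blocksFrom ∀Q ((∀Q , _) ∷ ps) = blocksFrom ∀Q ps
blocksFrom ∃Q ((∃Q , _) ∷ ps) = blocksFrom ∃Q ps
blocksFrom ∀Q ((∃Q , _) ∷ ps) = suc (blocksFrom ∃Q ps)
blocksFrom ∃Q ((∀Q , _) ∷ ps) = suc (blocksFrom ∀Q ps)

PrefixClass : Quant → ℕ → Prefix → Set
PrefixClass q k []             = ⊥
PrefixClass q k ((q' , _) ∷ ps) = (q' ≡ q) × (blocksFrom q ps ≡ k)

ΣKrom : ℕ → {τ : Vocab} → SOKrom τ → Set
ΣKrom k φ = PrefixClass ∃Q k (prefix φ)

ΠKrom : ℕ → {τ : Vocab} → SOKrom τ → Set
ΠKrom k φ = PrefixClass ∀Q k (prefix φ)

Equiv : {τ : Vocab} → SOKrom τ → SOKrom τ → Set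
Equiv {τ} φ ψ = (A : Structure τ) → (A ⊨ φ) ⇔ (A ⊨ ψ)

_≡L_ : ({τ : Vocab} → SOKrom τ → Set) → ({τ : Vocab} → SOKrom τ → Set) → Set
L₁ ≡L L₂ = (τ : Vocab) →
  ((φ : SOKrom τ) → L₁ φ → Σ (SOKrom τ) (λ ψ → L₂ ψ × Equiv φ ψ)) ×
  ((ψ : SOKrom τ) → L₂ ψ → Σ (SOKrom τ) (λ φ → L₁ φ × Equiv ψ φ))

Odd : ℕ → Set
Odd k = Σ ℕ (λ m → k ≡ 2 * m + 1)

Even : ℕ → Set
Even k = Σ ℕ (λ m → k ≡ 2 * m)

{-# OPTIONS --safe #-}
-- A Σ¹ₖ prefix with k odd, like a Π¹ₖ prefix with k even, ends with an
-- existential block.  Appending a vacuous universal relation variable adds a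
-- block without changing the meaning.  Conversely a trailing universal
-- variable R can be eliminated from a Krom sentence clause by clause:
-- ∀R (β ∨ H₁ ∨ H₂) is equivalent to β ∨ H₁ ∨ H₂ with every literal on R
-- replaced by ⊥ (take R empty or full to refute it), except for two
-- complementary pairs: R t̄ ∨ ¬ R ū becomes the Krom clauses β ∨ tᵢ = uᵢ
-- (take R = {ū}), and ¬ R t̄ ∨ ∃z̄ R z̄ is a tautology.  Eliminating the
-- trailing universal block in this way removes one block.
module Submission where

open import Defs
open import Data.Nat using (ℕ; zero; suc; _*_; _+_; _≤_; s≤s; z≤n)
open import Data.Nat.Properties using (+-suc; +-comm; suc-injective)
open import Data.Fin using (Fin) renaming (zero to fzero; suc to fsuc)
import Data.Fin.Properties as Fin
open import Data.Vec using (Vec; []; _∷_)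
open import Data.Vec.Properties using (≡-dec; ∷-injectiveˡ; ∷-injectiveʳ)
open import Data.List using (List; []; _∷_; _∷ʳ_; map; concatMap)
open import Data.List.Reverse using (Reverse; reverseView; []; _∶_∶ʳ_)
open import Data.List.Relation.Unary.All as All using (All; []; _∷_)
open import Data.List.Relation.Unary.All.Properties using (map⁺; map⁻; concat⁺; concat⁻; singleton⁻)
open import Data.List.Relation.Unary.Any using (Any; here; there)
open import Data.Bool using (true; false)
import Data.Bool.Properties as Bool
open import Data.Product using (Σ; _×_; _,_)
open import Data.Sum using (_⊎_; inj₁; inj₂)
import Data.Sum as Sum
open import Data.Unit using (tt)
open import Data.Empty using (⊥-elim)
open import Function using (id; _∘_)
open import Function.Bundles using (_⇔_; mk⇔; Equivalence)
open import Function.Properties.Equivalence using ()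
  renaming (refl to ⇔-refl; sym to ⇔-sym; trans to ⇔-trans)
open import Relation.Binary.PropositionalEquality
open import Relation.Nullary using (¬_; does; yes)
open import Relation.Nullary.Decidable using (dec-true; toSum)

open Equivalence using (to; from)

flipQ : Quant → Quant
flipQ ∀Q = ∃Q
flipQ ∃Q = ∀Q

flipQ-injective : ∀ {q q′} → flipQ q ≡ flipQ q′ → q ≡ q′
flipQ-injective {∀Q} {∀Q} _ = refl
flipQ-injective {∃Q} {∃Q} _ = refl

flips : ℕ → Quant → Quant
flips zero    q = q
flips (suc n) q = flips n (flipQ q)

flips-flipQ : ∀ n q → flips n (flipQ q) ≡ flipQ (flips n q)
flips-flipQ zero    q = refl
flips-flipQ (suc n) q = flips-flipQ n (flipQ q)

flips-even : ∀ m q → flips (2 * m) q ≡ q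
flips-even zero    q = refl
flips-even (suc m) ∀Q rewrite +-suc m (m + 0) = flips-even m ∀Q
flips-even (suc m) ∃Q rewrite +-suc m (m + 0) = flips-even m ∃Q

flips-odd : ∀ m q → flips (2 * m + 1) q ≡ flipQ q
flips-odd m q rewrite +-comm (2 * m) 1 = flips-even m (flipQ q)

lastQuant : Quant → Prefix → Quant
lastQuant q []             = q
lastQuant _ ((q , _) ∷ ps) = lastQuant q ps

lastQuant-∷ʳ : ∀ q ps {Q r} → lastQuant q (ps ∷ʳ (Q , r)) ≡ Q
lastQuant-∷ʳ q []             = refl
lastQuant-∷ʳ _ ((q , _) ∷ ps) = lastQuant-∷ʳ q ps

flipQ-lastQuant : ∀ q ps → flipQ (lastQuant q ps) ≡ flips (blocksFrom q ps) q
flipQ-lastQuant q  []               = refl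
flipQ-lastQuant ∀Q ((∀Q , _) ∷ ps) = flipQ-lastQuant ∀Q ps
flipQ-lastQuant ∃Q ((∃Q , _) ∷ ps) = flipQ-lastQuant ∃Q ps
flipQ-lastQuant ∀Q ((∃Q , _) ∷ ps) = flipQ-lastQuant ∃Q ps
flipQ-lastQuant ∃Q ((∀Q , _) ∷ ps) = flipQ-lastQuant ∀Q ps

blocksFrom-∷ʳ-same : ∀ q ps {Q r} → lastQuant q ps ≡ Q →
  blocksFrom q (ps ∷ʳ (Q , r)) ≡ blocksFrom q ps
blocksFrom-∷ʳ-same ∀Q []               refl = refl
blocksFrom-∷ʳ-same ∃Q []               refl = refl
blocksFrom-∷ʳ-same ∀Q ((∀Q , _) ∷ ps) eq   = blocksFrom-∷ʳ-same ∀Q ps eq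
blocksFrom-∷ʳ-same ∃Q ((∃Q , _) ∷ ps) eq   = blocksFrom-∷ʳ-same ∃Q ps eq
blocksFrom-∷ʳ-same ∀Q ((∃Q , _) ∷ ps) eq   = cong suc (blocksFrom-∷ʳ-same ∃Q ps eq)
blocksFrom-∷ʳ-same ∃Q ((∀Q , _) ∷ ps) eq   = cong suc (blocksFrom-∷ʳ-same ∀Q ps eq)

blocksFrom-∷ʳ-flip : ∀ q ps {Q r} → flipQ (lastQuant q ps) ≡ Q →
  blocksFrom q (ps ∷ʳ (Q , r)) ≡ suc (blocksFrom q ps)
blocksFrom-∷ʳ-flip ∀Q []               refl = refl
blocksFrom-∷ʳ-flip ∃Q []               refl = refl
blocksFrom-∷ʳ-flip ∀Q ((∀Q , _) ∷ ps) eq   = blocksFrom-∷ʳ-flip ∀Q ps eq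
blocksFrom-∷ʳ-flip ∃Q ((∃Q , _) ∷ ps) eq   = blocksFrom-∷ʳ-flip ∃Q ps eq
blocksFrom-∷ʳ-flip ∀Q ((∃Q , _) ∷ ps) eq   = cong suc (blocksFrom-∷ʳ-flip ∃Q ps eq)
blocksFrom-∷ʳ-flip ∃Q ((∀Q , _) ∷ ps) eq   = cong suc (blocksFrom-∷ʳ-flip ∀Q ps eq)

≡⇒⇔ : {X Y : Set} → X ≡ Y → X ⇔ Y
≡⇒⇔ refl = ⇔-refl

∀-cong : {I : Set} {P Q : I → Set} → (∀ i → P i ⇔ Q i) → (∀ i → P i) ⇔ (∀ i → Q i)
∀-cong P⇔Q = mk⇔ (λ h i → to (P⇔Q i) (h i)) (λ h i → from (P⇔Q i) (h i))

∀-⊎-swap : {I B : Set} {X Y : I → Set} → (∀ i → B ⊎ X i ⊎ Y i) ⇔ (∀ i → B ⊎ Y i ⊎ X i)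
∀-⊎-swap = mk⇔ (λ h i → Sum.map₂ Sum.swap (h i)) (λ h i → Sum.map₂ Sum.swap (h i))

∀-⊎-least : {I B Y₁ Y₂ : Set} {X₁ X₂ : I → Set} (i₀ : I) →
  (∀ i → Y₁ → X₁ i) → (∀ i → Y₂ → X₂ i) → (X₁ i₀ → Y₁) → (X₂ i₀ → Y₂) →
  (∀ i → B ⊎ X₁ i ⊎ X₂ i) ⇔ (B ⊎ Y₁ ⊎ Y₂)
∀-⊎-least i₀ Y₁⇒X₁ Y₂⇒X₂ X₁⇒Y₁ X₂⇒Y₂ = mk⇔
  (λ h → Sum.map₂ (Sum.map X₁⇒Y₁ X₂⇒Y₂) (h i₀))
  (λ h i → Sum.map₂ (Sum.map (Y₁⇒X₁ i) (Y₂⇒X₂ i)) h)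

All-cong : {A : Set} {P Q : A → Set} {xs : List A} →
  (∀ x → P x ⇔ Q x) → All P xs ⇔ All Q xs
All-cong P⇔Q = mk⇔ (All.map (λ {x} → to (P⇔Q x))) (All.map (λ {x} → from (P⇔Q x)))

All-singleton : {A : Set} {P : A → Set} {x : A} → All P (x ∷ []) ⇔ P x
All-singleton = mk⇔ singleton⁻ (_∷ [])

∀-All : {I A : Set} {P : I → A → Set} (xs : List A) →
  (∀ i → All (P i) xs) ⇔ All (λ x → ∀ i → P i x) xs
∀-All {P = P} xs = mk⇔ (to′ xs) (λ h i → All.map (λ f → f i) h)
  where
  to′ : ∀ xs → (∀ i → All (P i) xs) → All (λ x → ∀ i → P i x) xs
  to′ []       h = []
  to′ (x ∷ xs) h = (λ i → All.head (h i)) ∷ to′ xs (λ i → All.tail (h i))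

All-map : {A B : Set} {P : B → Set} {f : A → B} {xs : List A} →
  All P (map f xs) ⇔ All (P ∘ f) xs
All-map = mk⇔ map⁻ map⁺

All-concatMap : {A B : Set} {P : B → Set} {f : A → List B} {xs : List A} →
  All P (concatMap f xs) ⇔ All (All P ∘ f) xs
All-concatMap = mk⇔ (map⁻ ∘ concat⁻) (concat⁺ ∘ map⁺)

empty full : ∀ {D r} → Rel D r
empty _ = false
full  _ = true

singleton : ∀ {n r} → Vec (Fin n) r → Rel (Fin n) r
singleton w v = does (≡-dec Fin._≟_ v w)

module _ {n r : ℕ} where

  singleton-self : (w : Vec (Fin n) r) → singleton w w ≡ true
  singleton-self w = dec-true (≡-dec Fin._≟_ w w) refl

  singleton-sound : (w v : Vec (Fin n) r) → singleton w v ≡ true → v ≡ w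
  singleton-sound w v w∋v with ≡-dec Fin._≟_ v w
  ... | yes v≡w = v≡w

  true-or-not : (R : Rel (Fin n) r) (v : Vec (Fin n) r) → R v ≡ true ⊎ ¬ R v ≡ true
  true-or-not R v = toSum (R v Bool.≟ true)

  negated-or-nonempty : (R : Rel (Fin n) r) (v : Vec (Fin n) r) →
    ¬ R v ≡ true ⊎ Σ (Vec (Fin n) r) (λ w → R w ≡ true)
  negated-or-nonempty R v = Sum.swap (Sum.map₁ (v ,_) (true-or-not R v))

  -- The one complementary pair that survives: R = {w} is the worst case.
  ∀-pos-neg : {B : Set} (v w : Vec (Fin n) r) →
    ((R : Rel (Fin n) r) → B ⊎ R v ≡ true ⊎ ¬ R w ≡ true) ⇔ (B ⊎ v ≡ w)
  ∀-pos-neg {B} v w = mk⇔ (λ h → at-singleton (h (singleton w))) everywhere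
    where
    at-singleton : B ⊎ singleton w v ≡ true ⊎ ¬ singleton w w ≡ true → B ⊎ v ≡ w
    at-singleton (inj₁ b)          = inj₁ b
    at-singleton (inj₂ (inj₁ w∋v)) = inj₂ (singleton-sound w v w∋v)
    at-singleton (inj₂ (inj₂ w∌w)) = ⊥-elim (w∌w (singleton-self w))
    everywhere : B ⊎ v ≡ w → (R : Rel (Fin n) r) → B ⊎ R v ≡ true ⊎ ¬ R w ≡ true
    everywhere (inj₁ b)    R = inj₁ b
    everywhere (inj₂ refl) R = inj₂ (true-or-not R v)

snocEnv : ∀ {D q r} (p : Prefix) → Env D p → Rel D r → Env D (p ∷ʳ (q , r))
snocEnv []             _        R = R , tt
snocEnv ((_ , _) ∷ p) (R₀ , e) R = R₀ , snocEnv p e R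

semPrefix-map : ∀ {D} (p : Prefix) {φ ψ : Env D p → Set} →
  (∀ e → φ e → ψ e) → semPrefix D p φ → semPrefix D p ψ
semPrefix-map []              f h       = f tt h
semPrefix-map ((∀Q , _) ∷ p) f h       = λ R → semPrefix-map p (λ e → f (R , e)) (h R)
semPrefix-map ((∃Q , _) ∷ p) f (R , h) = R , semPrefix-map p (λ e → f (R , e)) h

semPrefix-cong : ∀ {D} (p : Prefix) {φ ψ : Env D p → Set} →
  (∀ e → φ e ⇔ ψ e) → semPrefix D p φ ⇔ semPrefix D p ψ
semPrefix-cong p φ⇔ψ =
  mk⇔ (semPrefix-map p (λ e → to (φ⇔ψ e))) (semPrefix-map p (λ e → from (φ⇔ψ e)))

semPrefix-∀ʳ : ∀ {D r} (p : Prefix) (φ : Env D (p ∷ʳ (∀Q , r)) → Set) →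
  semPrefix D (p ∷ʳ (∀Q , r)) φ ⇔ semPrefix D p (λ e → (R : Rel D r) → φ (snocEnv p e R))
semPrefix-∀ʳ []              φ = ⇔-refl
semPrefix-∀ʳ ((∀Q , _) ∷ p) φ =
  mk⇔ (λ h R₀ → to (IH R₀) (h R₀)) (λ h R₀ → from (IH R₀) (h R₀))
  where IH = λ R₀ → semPrefix-∀ʳ p (λ e → φ (R₀ , e))
semPrefix-∀ʳ ((∃Q , _) ∷ p) φ =
  mk⇔ (λ (R₀ , h) → R₀ , to (IH R₀) h) (λ (R₀ , h) → R₀ , from (IH R₀) h)
  where IH = λ R₀ → semPrefix-∀ʳ p (λ e → φ (R₀ , e))

module _ {τ : Vocab} {nv : ℕ} where

  shiftH : ∀ {x p} → HLit τ nv p → HLit τ nv (x ∷ p)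
  shiftH (posR i ts) = posR (fsuc i) ts
  shiftH (negR i ts) = negR (fsuc i) ts
  shiftH (exR i)     = exR (fsuc i)
  shiftH botH        = botH

  liftH : (p : Prefix) {x : Quant × ℕ} → HLit τ nv p → HLit τ nv (p ∷ʳ x)
  liftH p       botH               = botH
  liftH (_ ∷ p) (posR fzero ts)    = posR fzero ts
  liftH (_ ∷ p) (posR (fsuc i) ts) = shiftH (liftH p (posR i ts))
  liftH (_ ∷ p) (negR fzero ts)    = negR fzero ts
  liftH (_ ∷ p) (negR (fsuc i) ts) = shiftH (liftH p (negR i ts))
  liftH (_ ∷ p) (exR fzero)        = exR fzero
  liftH (_ ∷ p) (exR (fsuc i))     = shiftH (liftH p (exR i))

  liftClause : (p : Prefix) {x : Quant × ℕ} → Clause τ nv p → Clause τ nv (p ∷ʳ x)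
  liftClause p (clause βs h₁ h₂) = clause βs (liftH p h₁) (liftH p h₂)

  data LastLit (r : ℕ) : Set where
    R⁺ R⁻ : Vec (Term τ nv) r → LastLit r
    ∃R    : LastLit r

  data HView (p : Prefix) (r : ℕ) : Set where
    old : HLit τ nv p → HView p r
    new : LastLit r → HView p r

  shiftV : ∀ {x p r} → HView p r → HView (x ∷ p) r
  shiftV (old h) = old (shiftH h)
  shiftV (new l) = new l

  viewH : (p : Prefix) {Q : Quant} {r : ℕ} → HLit τ nv (p ∷ʳ (Q , r)) → HView p r
  viewH p       botH               = old botH
  viewH []      (posR fzero ts)    = new (R⁺ ts)
  viewH []      (negR fzero ts)    = new (R⁻ ts)
  viewH []      (exR fzero)        = new ∃R
  viewH (_ ∷ p) (posR fzero ts)    = old (posR fzero ts)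
  viewH (_ ∷ p) (posR (fsuc i) ts) = shiftV (viewH p (posR i ts))
  viewH (_ ∷ p) (negR fzero ts)    = old (negR fzero ts)
  viewH (_ ∷ p) (negR (fsuc i) ts) = shiftV (viewH p (negR i ts))
  viewH (_ ∷ p) (exR fzero)        = old (exR fzero)
  viewH (_ ∷ p) (exR (fsuc i))     = shiftV (viewH p (exR i))

  equalities : ∀ {p r} → List (Lit τ nv) → Vec (Term τ nv) r → Vec (Term τ nv) r →
    List (Clause τ nv p)
  equalities βs []       []       = []
  equalities βs (t ∷ ts) (u ∷ us) = clause (pos (eqA t u) ∷ βs) botH botH ∷ equalities βs ts us

  resolve : ∀ {p r} → List (Lit τ nv) → LastLit r → LastLit r → List (Clause τ nv p)
  resolve βs (R⁺ t) (R⁻ u) = equalities βs t u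
  resolve βs (R⁻ t) (R⁺ u) = equalities βs u t
  resolve βs (R⁻ _) ∃R     = []
  resolve βs ∃R     (R⁻ _) = []
  resolve βs (R⁺ _) (R⁺ _) = clause βs botH botH ∷ []
  resolve βs (R⁺ _) ∃R     = clause βs botH botH ∷ []
  resolve βs ∃R     (R⁺ _) = clause βs botH botH ∷ []
  resolve βs ∃R     ∃R     = clause βs botH botH ∷ []
  resolve βs (R⁻ _) (R⁻ _) = clause βs botH botH ∷ []

  combine : ∀ {p r} → List (Lit τ nv) → HView p r → HView p r → List (Clause τ nv p)
  combine βs (old a) (old b) = clause βs a b ∷ []
  combine βs (old a) (new _) = clause βs a botH ∷ []
  combine βs (new _) (old b) = clause βs botH b ∷ []
  combine βs (new l) (new m) = resolve βs l m

  eliminateClause : (p : Prefix) {Q : Quant} {r : ℕ} → Clause τ nv (p ∷ʳ (Q , r)) →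
    List (Clause τ nv p)
  eliminateClause p (clause βs h₁ h₂) = combine βs (viewH p h₁) (viewH p h₂)

  eliminate : (p : Prefix) {Q : Quant} {r : ℕ} → List (Clause τ nv (p ∷ʳ (Q , r))) →
    List (Clause τ nv p)
  eliminate p = concatMap (eliminateClause p)

module _ {τ : Vocab} (A : Structure τ) {nv : ℕ} (s : Fin nv → Dom A) where

  ⟦_⟧ : ∀ {n} → Vec (Term τ nv) n → Vec (Dom A) n
  ⟦_⟧ = evalTerms A s

  satLast : ∀ {r} → Rel (Dom A) r → LastLit r → Set
  satLast R (R⁺ ts)   = R ⟦ ts ⟧ ≡ true
  satLast R (R⁻ ts)   = ¬ R ⟦ ts ⟧ ≡ true
  satLast {r} R ∃R    = Σ (Vec (Dom A) r) (λ v → R v ≡ true)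

  satView : ∀ {p r} → Env (Dom A) p → Rel (Dom A) r → HView p r → Set
  satView e R (old h) = satH A e s h
  satView e R (new l) = satLast R l

  satH-shiftH : ∀ {q r p} (R₀ : Rel (Dom A) r) (e : Env (Dom A) p) (h : HLit τ nv p) →
    satH A {p = (q , r) ∷ p} (R₀ , e) s (shiftH h) ≡ satH A e s h
  satH-shiftH R₀ e (posR i ts) = refl
  satH-shiftH R₀ e (negR i ts) = refl
  satH-shiftH R₀ e (exR i)     = refl
  satH-shiftH R₀ e botH        = refl

  satView-shiftV : ∀ {q r′ p r} (R₀ : Rel (Dom A) r′) (e : Env (Dom A) p)
    (R : Rel (Dom A) r) (v : HView p r) →
    satView {p = (q , r′) ∷ p} (R₀ , e) R (shiftV v) ≡ satView e R v
  satView-shiftV R₀ e R (old h) = satH-shiftH R₀ e h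
  satView-shiftV R₀ e R (new l) = refl

  viewH-sound : (p : Prefix) {Q : Quant} {r : ℕ} (e : Env (Dom A) p) (R : Rel (Dom A) r)
    (h : HLit τ nv (p ∷ʳ (Q , r))) →
    satH A (snocEnv p e R) s h ≡ satView e R (viewH p h)
  viewH-sound p                e        R botH               = refl
  viewH-sound []               _        R (posR fzero ts)    = refl
  viewH-sound []               _        R (negR fzero ts)    = refl
  viewH-sound []               _        R (exR fzero)        = refl
  viewH-sound ((_ , _) ∷ p)   (R₀ , e) R (posR fzero ts)    = refl
  viewH-sound ((_ , _) ∷ p)   (R₀ , e) R (posR (fsuc i) ts) =
    trans (viewH-sound p e R (posR i ts)) (sym (satView-shiftV R₀ e R (viewH p (posR i ts))))
  viewH-sound ((_ , _) ∷ p)   (R₀ , e) R (negR fzero ts)    = refl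
  viewH-sound ((_ , _) ∷ p)   (R₀ , e) R (negR (fsuc i) ts) =
    trans (viewH-sound p e R (negR i ts)) (sym (satView-shiftV R₀ e R (viewH p (negR i ts))))
  viewH-sound ((_ , _) ∷ p)   (R₀ , e) R (exR fzero)        = refl
  viewH-sound ((_ , _) ∷ p)   (R₀ , e) R (exR (fsuc i))     =
    trans (viewH-sound p e R (exR i)) (sym (satView-shiftV R₀ e R (viewH p (exR i))))

  liftH-sound : (p : Prefix) {Q : Quant} {r : ℕ} (e : Env (Dom A) p) (R : Rel (Dom A) r)
    (h : HLit τ nv p) → satH A (snocEnv {q = Q} p e R) s (liftH p h) ≡ satH A e s h
  liftH-sound p                e        R botH               = refl
  liftH-sound ((_ , _) ∷ p)   (R₀ , e) R (posR fzero ts)    = refl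
  liftH-sound ((_ , _) ∷ p)   (R₀ , e) R (posR (fsuc i) ts) =
    trans (satH-shiftH R₀ (snocEnv p e R) (liftH p (posR i ts))) (liftH-sound p e R (posR i ts))
  liftH-sound ((_ , _) ∷ p)   (R₀ , e) R (negR fzero ts)    = refl
  liftH-sound ((_ , _) ∷ p)   (R₀ , e) R (negR (fsuc i) ts) =
    trans (satH-shiftH R₀ (snocEnv p e R) (liftH p (negR i ts))) (liftH-sound p e R (negR i ts))
  liftH-sound ((_ , _) ∷ p)   (R₀ , e) R (exR fzero)        = refl
  liftH-sound ((_ , _) ∷ p)   (R₀ , e) R (exR (fsuc i))     =
    trans (satH-shiftH R₀ (snocEnv p e R) (liftH p (exR i))) (liftH-sound p e R (exR i))

  All-liftClause : (p : Prefix) {Q : Quant} {r : ℕ} (e : Env (Dom A) p) (R : Rel (Dom A) r)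
    (cs : List (Clause τ nv p)) →
    All (satClause A (snocEnv {q = Q} p e R) s) (map (liftClause p) cs) ⇔ All (satClause A e s) cs
  All-liftClause p e R cs = ⇔-trans All-map (All-cong lift-sound)
    where
    lift-sound : ∀ c → satClause A (snocEnv p e R) s (liftClause p c) ⇔ satClause A e s c
    lift-sound (clause βs h₁ h₂) = ≡⇒⇔ (cong₂ (λ X Y → Any (satLit A s) βs ⊎ X ⊎ Y)
      (liftH-sound p e R h₁) (liftH-sound p e R h₂))

  refuter : ∀ {r} → LastLit {τ} {nv} r → Rel (Dom A) r
  refuter (R⁺ _) = empty
  refuter (R⁻ _) = full
  refuter ∃R     = empty

  refuter-refutes : ∀ {r} (l : LastLit {τ} {nv} r) → ¬ satLast (refuter l) l
  refuter-refutes (R⁺ _) ()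
  refuter-refutes (R⁻ _) ¬true = ¬true refl
  refuter-refutes ∃R     (_ , ())

  module _ {p : Prefix} (e : Env (Dom A) p) (βs : List (Lit τ nv)) where

    private
      B = Any (satLit A s) βs

    All-equalities : ∀ {r} (ts us : Vec (Term τ nv) r) →
      All (satClause A e s) (equalities βs ts us) ⇔ (B ⊎ ⟦ ts ⟧ ≡ ⟦ us ⟧)
    All-equalities []       []       = mk⇔ (λ _ → inj₂ refl) (λ _ → [])
    All-equalities (t ∷ ts) (u ∷ us) = mk⇔ to′ from′
      where
      IH = All-equalities ts us
      to′ : All (satClause A e s) (equalities βs (t ∷ ts) (u ∷ us)) → B ⊎ ⟦ t ∷ ts ⟧ ≡ ⟦ u ∷ us ⟧
      to′ (inj₁ (here t≡u) ∷ cs) = Sum.map₂ (cong₂ _∷_ t≡u) (to IH cs)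
      to′ (inj₁ (there b)  ∷ _)  = inj₁ b
      to′ (inj₂ (inj₁ ())  ∷ _)
      to′ (inj₂ (inj₂ ())  ∷ _)
      from′ : B ⊎ ⟦ t ∷ ts ⟧ ≡ ⟦ u ∷ us ⟧ → All (satClause A e s) (equalities βs (t ∷ ts) (u ∷ us))
      from′ (inj₁ b)  = inj₁ (there b) ∷ from IH (inj₁ b)
      from′ (inj₂ eq) = inj₁ (here (∷-injectiveˡ eq)) ∷ from IH (inj₂ (∷-injectiveʳ eq))

    both-refuted : ∀ {r} {X₁ X₂ : Rel (Dom A) r → Set} (R₀ : Rel (Dom A) r) → ¬ X₁ R₀ → ¬ X₂ R₀ →
      (∀ R → B ⊎ X₁ R ⊎ X₂ R) ⇔ All (satClause A e s) (clause βs botH botH ∷ [])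
    both-refuted R₀ ¬X₁ ¬X₂ = ⇔-trans (∀-⊎-least R₀ (λ _ ()) (λ _ ()) ¬X₁ ¬X₂) (⇔-sym All-singleton)

    resolve-sound : ∀ {r} (l m : LastLit r) →
      ((R : Rel (Dom A) r) → B ⊎ satLast R l ⊎ satLast R m) ⇔ All (satClause A e s) (resolve βs l m)
    resolve-sound (R⁺ t) (R⁻ u) = ⇔-trans (∀-pos-neg ⟦ t ⟧ ⟦ u ⟧) (⇔-sym (All-equalities t u))
    resolve-sound (R⁻ t) (R⁺ u) =
      ⇔-trans ∀-⊎-swap (⇔-trans (∀-pos-neg ⟦ u ⟧ ⟦ t ⟧) (⇔-sym (All-equalities u t)))
    resolve-sound (R⁻ t) ∃R     = mk⇔ (λ _ → []) (λ _ R → inj₂ (negated-or-nonempty R ⟦ t ⟧))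
    resolve-sound ∃R     (R⁻ u) =
      mk⇔ (λ _ → []) (λ _ R → inj₂ (Sum.swap (negated-or-nonempty R ⟦ u ⟧)))
    resolve-sound (R⁺ _) (R⁺ _) = both-refuted empty (λ ()) (λ ())
    resolve-sound (R⁺ _) ∃R     = both-refuted empty (λ ()) (λ { (_ , ()) })
    resolve-sound ∃R     (R⁺ _) = both-refuted empty (λ { (_ , ()) }) (λ ())
    resolve-sound ∃R     ∃R     = both-refuted empty (λ { (_ , ()) }) (λ { (_ , ()) })
    resolve-sound (R⁻ _) (R⁻ _) = both-refuted full (λ ¬true → ¬true refl) (λ ¬true → ¬true refl)

    combine-sound : ∀ {r} (v w : HView p r) →
      ((R : Rel (Dom A) r) → B ⊎ satView e R v ⊎ satView e R w) ⇔ All (satClause A e s) (combine βs v w)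
    combine-sound (old a) (old b) =
      ⇔-trans (∀-⊎-least empty (λ _ → id) (λ _ → id) id id) (⇔-sym All-singleton)
    combine-sound (old a) (new l) =
      ⇔-trans (∀-⊎-least (refuter l) (λ _ → id) (λ _ ()) id (refuter-refutes l)) (⇔-sym All-singleton)
    combine-sound (new l) (old b) =
      ⇔-trans (∀-⊎-least (refuter l) (λ _ ()) (λ _ → id) (refuter-refutes l) id) (⇔-sym All-singleton)
    combine-sound (new l) (new m) = resolve-sound l m

  eliminateClause-sound : (p : Prefix) {r : ℕ} (e : Env (Dom A) p)
    (c : Clause τ nv (p ∷ʳ (∀Q , r))) →
    ((R : Rel (Dom A) r) → satClause A (snocEnv p e R) s c) ⇔ All (satClause A e s) (eliminateClause p c)
  eliminateClause-sound p e (clause βs h₁ h₂) =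
    ⇔-trans (∀-cong λ R → ≡⇒⇔ (cong₂ (λ X Y → Any (satLit A s) βs ⊎ X ⊎ Y)
                                      (viewH-sound p e R h₁) (viewH-sound p e R h₂)))
            (combine-sound e βs (viewH p h₁) (viewH p h₂))

  All-eliminate : (p : Prefix) {r : ℕ} (e : Env (Dom A) p)
    (cs : List (Clause τ nv (p ∷ʳ (∀Q , r)))) →
    ((R : Rel (Dom A) r) → All (satClause A (snocEnv p e R) s) cs) ⇔
    All (satClause A e s) (eliminate p cs)
  All-eliminate p e cs =
    ⇔-trans (∀-All cs) (⇔-trans (All-cong (eliminateClause-sound p e)) (⇔-sym All-concatMap))

∀-elimination : ∀ {τ} (p : Prefix) r nv (cs : List (Clause τ nv (p ∷ʳ (∀Q , r)))) →
  Equiv (soKrom (p ∷ʳ (∀Q , r)) nv cs) (soKrom p nv (eliminate p cs))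
∀-elimination p r nv cs A = ⇔-trans (semPrefix-∀ʳ p _) (semPrefix-cong p λ e → mk⇔
  (λ h s → to (All-eliminate A s p e cs) (λ R → h R s))
  (λ h R s → from (All-eliminate A s p e cs) (h s) R))

vacuous-∀ : ∀ {τ} (p : Prefix) r nv (cs : List (Clause τ nv p)) →
  Equiv (soKrom p nv cs) (soKrom (p ∷ʳ (∀Q , r)) nv (map (liftClause p) cs))
vacuous-∀ p r nv cs A = ⇔-sym (⇔-trans (semPrefix-∀ʳ p _) (semPrefix-cong p λ e → mk⇔
  (λ h s → to (All-liftClause A s p e empty cs) (h empty s))
  (λ h R s → from (All-liftClause A s p e R cs) (h s))))

-- The hypothesis flips k q ≡ ∀Q says that k alternating blocks starting
-- with q end with an existential block.
append∀ : ∀ {τ} q k → flips k q ≡ ∀Q → (φ : SOKrom τ) → PrefixClass q k (prefix φ) →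
  Σ (SOKrom τ) (λ ψ → PrefixClass q (suc k) (prefix ψ) × Equiv φ ψ)
append∀ q _ ends∃ (soKrom ((_ , r₀) ∷ ps) nv cs) (refl , refl) =
  soKrom (p ∷ʳ (∀Q , 0)) nv (map (liftClause p) cs) ,
  (refl , blocksFrom-∷ʳ-flip q ps (trans (flipQ-lastQuant q ps) ends∃)) ,
  vacuous-∀ p 0 nv cs
  where p = (q , r₀) ∷ ps

dropTrailing∀s : ∀ {τ} q r₀ {ps} → Reverse ps → ∀ nv (cs : List (Clause τ nv ((q , r₀) ∷ ps))) j →
  blocksFrom q ps ≡ suc (suc j) → lastQuant q ps ≡ ∀Q →
  Σ (SOKrom τ) (λ φ → PrefixClass q (suc j) (prefix φ) × Equiv (soKrom ((q , r₀) ∷ ps) nv cs) φ)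
dropTrailing∀s q r₀ [] nv cs j () _
dropTrailing∀s q r₀ (ps ∶ _ ∶ʳ (∃Q , r)) nv cs j _ last∀ with () ← trans (sym (lastQuant-∷ʳ q ps)) last∀
dropTrailing∀s q r₀ (ps ∶ rps ∶ʳ (∀Q , r)) nv cs j blocks _ with lastQuant q ps in last
... | ∀Q =
  let (φ , class , equiv) = dropTrailing∀s q r₀ rps nv (eliminate ((q , r₀) ∷ ps) cs) j
                              (trans (sym (blocksFrom-∷ʳ-same q ps last)) blocks) last
  in φ , class , λ A → ⇔-trans (∀-elimination ((q , r₀) ∷ ps) r nv cs A) (equiv A)
... | ∃Q =
  soKrom ((q , r₀) ∷ ps) nv (eliminate ((q , r₀) ∷ ps) cs) ,
  (refl , suc-injective (trans (sym (blocksFrom-∷ʳ-flip q ps (cong flipQ last))) blocks)) ,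
  ∀-elimination ((q , r₀) ∷ ps) r nv cs

drop∀ : ∀ {τ} q j → flips (suc j) q ≡ ∀Q → (ψ : SOKrom τ) → PrefixClass q (suc (suc j)) (prefix ψ) →
  Σ (SOKrom τ) (λ φ → PrefixClass q (suc j) (prefix φ) × Equiv ψ φ)
drop∀ q j ends∃ (soKrom ((_ , r₀) ∷ ps) nv cs) (refl , blocks) =
  dropTrailing∀s q r₀ (reverseView ps) nv cs j blocks (flipQ-injective (begin
    flipQ (lastQuant q ps)      ≡⟨ flipQ-lastQuant q ps ⟩
    flips (blocksFrom q ps) q   ≡⟨ cong (λ n → flips n q) blocks ⟩
    flips (suc j) (flipQ q)     ≡⟨ flips-flipQ (suc j) q ⟩
    flipQ (flips (suc j) q)     ≡⟨ cong flipQ ends∃ ⟩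
    ∃Q                          ∎))
  where open ≡-Reasoning

∀-block-collapses : ∀ q j → flips (suc j) q ≡ ∀Q →
  (λ {τ} (φ : SOKrom τ) → PrefixClass q (suc j) (prefix φ)) ≡L
  (λ {τ} (φ : SOKrom τ) → PrefixClass q (suc (suc j)) (prefix φ))
∀-block-collapses q j ends∃ τ = append∀ q (suc j) ends∃ , drop∀ q j ends∃

corollary2p2 : (k : ℕ) → 1 ≤ k →
    (Odd k → ΣKrom k ≡L ΣKrom (suc k)) ×
    (Even k → ΠKrom k ≡L ΠKrom (suc k))
corollary2p2 (suc j) (s≤s z≤n) =
  (λ (m , k≡2m+1) → ∀-block-collapses ∃Q j (trans (cong (λ n → flips n ∃Q) k≡2m+1) (flips-odd m ∃Q))) ,
  (λ (m , k≡2m)   → ∀-block-collapses ∀Q j (trans (cong (λ n → flips n ∀Q) k≡2m) (flips-even m ∀Q)))
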